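{- For every integer $n\ge 2$, $\mathrm{Spec}(G_n)=\{1,n\}$.
   Context: All matchings considered are perfect matchings. For a perfect matching $M$ of a graph $G$, a forcing set for $M$ is a subset $S\subseteq M$ contained in no other perfect matching of $G$; $f(G,M)$ is the minimum size of a forcing set for $M$, and $\mathrm{Spec}(G)=\{f(G,M) \mid M \text{ a perfect matching of } G\}$. The graph $G_n$ is obtained from the cycle $C_{2n}=v_1v_2\cdots v_{2n}v_1$ by replacing every other edge by a cycle of length $4$: for each $i=1,\dots,n$, the edge $v_{2i}v_{2i+1}$ (indices mod $2n$) is kept and two new vertices $a_i,b_i$ are added together with edges $v_{2i}a_i$, $a_ib_i$, $b_iv_{2i+1}$, so that $v_{2i}a_ib_iv_{2i+1}$ is a $4$-cycle; the edges $v_{2i-1}v_{2i}$ remain as in $C_{2n}$. -}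

module Defs where

open import Data.Nat using (ℕ; zero; suc; _≤_; _*_)
open import Data.Fin using (Fin; zero; suc; remQuot)
open import Data.Fin.Subset using (Subset; _∈_; _⊆_; ∣_∣)
open import Data.Product using (Σ; ∃; ∃-syntax; _×_; _,_; proj₁; proj₂)
open import Data.Sum using (_⊎_)
open import Relation.Binary.PropositionalEquality using (_≡_)

record Graph : Set₁ where
  field
    V    : Set
    nE   : ℕ
    ends : Fin nE → V × V

module _ (G : Graph) where
  open Graph G

  Incident : V → Fin nE → Set
  Incident x e = x ≡ proj₁ (ends e) ⊎ x ≡ proj₂ (ends e)

  IsPerfectMatching : Subset nE → Set
  IsPerfectMatching M =
    ∀ x → ∃[ e ] ((e ∈ M × Incident x e) ×
                  (∀ e′ → e′ ∈ M → Incident x e′ → e′ ≡ e))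

  IsForcingSet : Subset nE → Subset nE → Set
  IsForcingSet M S =
    S ⊆ M × (∀ M′ → IsPerfectMatching M′ → S ⊆ M′ → M′ ≡ M)

  ForcingNumber : Subset nE → ℕ → Set
  ForcingNumber M k =
    (∃[ S ] (IsForcingSet M S × ∣ S ∣ ≡ k)) ×
    (∀ S → IsForcingSet M S → k ≤ ∣ S ∣)

  InSpec : ℕ → Set
  InSpec k = ∃[ M ] (IsPerfectMatching M × ForcingNumber M k)

-- cyclic successor on Fin n  (i ↦ i+1 mod n)
next : ∀ {n} → Fin n → Fin n
next {suc zero} zero = zero
next {suc (suc m)} zero = suc zero
next {suc (suc m)} (suc i) with next {suc m} i
... | zero  = zero
... | suc j = suc (suc j)

-- Vertices of G_n, with i : Fin n the 0-based version of i ∈ {1..n}: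
--   vodd i = v_{2i-1},  veven i = v_{2i},  a i = a_i,  b i = b_i.
-- Hence v_{2i+1} (indices mod 2n) is  vodd (next i).
data Vtx (n : ℕ) : Set where
  vodd veven a b : Fin n → Vtx n

edgeG : ∀ {n} → Fin n → Fin 5 → Vtx n × Vtx n
edgeG i zero                         = vodd i  , veven i
edgeG i (suc zero)                   = veven i , vodd (next i)
edgeG i (suc (suc zero))             = veven i , a i
edgeG i (suc (suc (suc zero)))       = a i     , b i
edgeG i (suc (suc (suc (suc zero)))) = b i     , vodd (next i)

G : ℕ → Graph
G n = record
  { V    = Vtx n
  ; nE   = n * 5
  ; ends = λ e → let (i , k) = remQuot 5 e in edgeG i k
  }

-- In a perfect matching of G_n every block i (the edges v_{2i-1}v_{2i}, v_{2i}v_{2i+1} and the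
-- 4-cycle v_{2i}a_ib_iv_{2i+1}) is matched in one of three ways: short (v_{2i-1}v_{2i}, a_ib_i),
-- bridge (v_{2i}v_{2i+1}, a_ib_i) or detour (v_{2i}a_i, b_iv_{2i+1}).  Covering v_{2i+1} exactly
-- once forces block i+1 to be short iff block i is, so the perfect matchings are the all-short
-- one and the 2^n matchings choosing bridge or detour in every block.  The edge v_1v_2 alone
-- forces the all-short matching.  A forcing set of any other matching meets every block, since
-- swapping bridge and detour in a block it misses gives another perfect matching containing it;
-- one edge per block (v_{2i}v_{2i+1} or v_{2i}a_i) suffices.
module Submission where

open import Defs
open import Data.Bool using (Bool; true; false)
open import Data.Empty using (⊥-elim)
open import Data.Fin using (Fin; zero; suc; combine; remQuot; inject₁; fromℕ; _≟_)
open import Data.Fin.Induction using (<-weakInduction)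
open import Data.Fin.Patterns using (0F; 1F; 2F; 3F; 4F)
open import Data.Fin.Properties using (combine-remQuot; remQuot-combine)
open import Data.Fin.Subset using (Subset; inside; outside; _∈_; _∉_; _⊆_; ∣_∣; ⁅_⁆; Nonempty)
open import Data.Fin.Subset.Properties
  using (x∈⁅x⁆; x∈⁅y⁆⇒x≡y; ∣⁅x⁆∣≡1; p⊆q⇒∣p∣≤∣q∣; nonempty?; Empty-unique; ⊥⊆)
open import Data.Nat using (ℕ; zero; suc; _+_; _*_; _≤_; _<_; z≤n)
open import Data.Nat.Properties using (suc-injective; +-mono-≤; ≤-antisym)
open import Data.Product using (∃-syntax; _×_; _,_; proj₁; proj₂; uncurry)
open import Data.Sum using (_⊎_; inj₁; inj₂)
open import Data.Vec
  using (Vec; []; _∷_; _++_; concat; map; lookup; tabulate; replicate; updateAt; group; here; there)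
open import Data.Vec.Properties
  using (lookup-concat; lookup-map; lookup-replicate; lookup∘tabulate; lookup∘updateAt;
         lookup∘updateAt′; map-∘; map-cong; []=⇒lookup; lookup⇒[]=; ∷-injectiveˡ)
open import Data.Vec.Membership.Propositional using () renaming (_∈_ to _∈ᵛ_)
open import Data.Vec.Membership.Propositional.Properties using (∈-map⁺; fromAny)
open import Data.Vec.Relation.Binary.Pointwise.Extensional using (ext; Pointwise-≡⇒≡)
open import Data.Vec.Relation.Unary.All using (All; []; _∷_)
import Data.Vec.Relation.Unary.All as All
open import Data.Vec.Relation.Unary.AllPairs using ([]; _∷_)
open import Data.Vec.Relation.Unary.Any using (here; there)
open import Data.Vec.Relation.Unary.Any.Properties using (map⁻)
open import Data.Vec.Relation.Unary.Unique.Propositional using (Unique)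
import Data.Vec.Relation.Unary.Unique.Propositional.Properties as Unique
open import Function using (_∘_)
open import Function.Bundles using (_⇔_; mk⇔; Equivalence)
open import Relation.Nullary using (yes; no)
open import Relation.Binary.PropositionalEquality

open Equivalence

-- Counting members of subsets

lookup≡outside⇒∉ : ∀ {N} {p : Subset N} {x} → lookup p x ≡ outside → x ∉ p
lookup≡outside⇒∉ px x∈p with () ← trans (sym px) ([]=⇒lookup x∈p)

module _ {N : ℕ} (p : Subset N) where

  ∣map-lookup∣≡0⇔ : ∀ {d} (xs : Vec (Fin N) d) →
                    ∣ map (lookup p) xs ∣ ≡ 0 ⇔ (∀ {e} → e ∈ᵛ xs → e ∉ p)
  ∣map-lookup∣≡0⇔ [] = mk⇔ (λ _ ()) (λ _ → refl)
  ∣map-lookup∣≡0⇔ (x ∷ xs) with lookup p x in px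
  ... | inside  = mk⇔ (λ ()) (λ none → ⊥-elim (none (here refl) (lookup⇒[]= x p px)))
  ... | outside = mk⇔
    (λ { c (here refl) x∈p → lookup≡outside⇒∉ px x∈p
       ; c (there e∈xs)    → to (∣map-lookup∣≡0⇔ xs) c e∈xs })
    (λ none → from (∣map-lookup∣≡0⇔ xs) (λ e∈xs → none (there e∈xs)))

  ∣map-lookup∣≡1⇔ : ∀ {d} {xs : Vec (Fin N) d} → Unique xs →
    ∣ map (lookup p) xs ∣ ≡ 1 ⇔ (∃[ e ] ((e ∈ p × e ∈ᵛ xs) × ∀ e′ → e′ ∈ p → e′ ∈ᵛ xs → e′ ≡ e))
  ∣map-lookup∣≡1⇔ {xs = []} [] = mk⇔ (λ ()) (λ { (_ , (_ , ()) , _) })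
  ∣map-lookup∣≡1⇔ {xs = x ∷ xs} (x∉xs ∷ unique) with lookup p x in px
  ... | inside = mk⇔
    (λ c → x , (lookup⇒[]= x p px , here refl) , λ
      { _  _    (here refl)     → refl
      ; e′ e′∈p (there e′∈xs) → ⊥-elim (to (∣map-lookup∣≡0⇔ xs) (suc-injective c) e′∈xs e′∈p) })
    (λ (_ , _ , unique-e) → cong suc (from (∣map-lookup∣≡0⇔ xs) λ e′∈xs e′∈p →
      All.lookup x∉xs e′∈xs (trans (unique-e x (lookup⇒[]= x p px) (here refl))
                                   (sym (unique-e _ e′∈p (there e′∈xs))))))
  ... | outside = mk⇔
    (λ c → let (e , (e∈p , e∈xs) , unique-e) = to (∣map-lookup∣≡1⇔ unique) c in
      e , (e∈p , there e∈xs) , λ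
        { e′ e′∈p (here refl)     → ⊥-elim (lookup≡outside⇒∉ px e′∈p)
        ; e′ e′∈p (there e′∈xs) → unique-e e′ e′∈p e′∈xs })
    (λ { (e , (e∈p , here refl) , _) → ⊥-elim (lookup≡outside⇒∉ px e∈p)
       ; (e , (e∈p , there e∈xs) , unique-e) → from (∣map-lookup∣≡1⇔ unique)
           (e , (e∈p , e∈xs) , λ e′ e′∈p e′∈xs → unique-e e′ e′∈p (there e′∈xs)) })

  ∃!-member⇔∣map-lookup∣≡1 :
    ∀ {d} {xs : Vec (Fin N) d} {I : Fin N → Set} → Unique xs → (∀ {e} → I e ⇔ e ∈ᵛ xs) →
    (∃[ e ] ((e ∈ p × I e) × ∀ e′ → e′ ∈ p → I e′ → e′ ≡ e)) ⇔ ∣ map (lookup p) xs ∣ ≡ 1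
  ∃!-member⇔∣map-lookup∣≡1 unique enum = mk⇔
    (λ (e , (e∈p , Ie) , unique-e) → from (∣map-lookup∣≡1⇔ unique)
      (e , (e∈p , to enum Ie) , λ e′ e′∈p e′∈xs → unique-e e′ e′∈p (from enum e′∈xs)))
    (λ c → let (e , (e∈p , e∈xs) , unique-e) = to (∣map-lookup∣≡1⇔ unique) c in
      e , (e∈p , from enum e∈xs) , λ e′ e′∈p Ie′ → unique-e e′ e′∈p (to enum Ie′))

∣p++q∣≡∣p∣+∣q∣ : ∀ {k l} (p : Subset k) (q : Subset l) → ∣ p ++ q ∣ ≡ ∣ p ∣ + ∣ q ∣
∣p++q∣≡∣p∣+∣q∣ []            q = refl
∣p++q∣≡∣p∣+∣q∣ (inside  ∷ p) q = cong suc (∣p++q∣≡∣p∣+∣q∣ p q)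
∣p++q∣≡∣p∣+∣q∣ (outside ∷ p) q = ∣p++q∣≡∣p∣+∣q∣ p q

nonempty⇒0<∣p∣ : ∀ {k} {p : Subset k} → Nonempty p → 0 < ∣ p ∣
nonempty⇒0<∣p∣ {p = p} (x , x∈p) =
  subst (_≤ ∣ p ∣) (∣⁅x⁆∣≡1 x) (p⊆q⇒∣p∣≤∣q∣ λ y∈⁅x⁆ → subst (_∈ p) (sym (x∈⁅y⁆⇒x≡y x y∈⁅x⁆)) x∈p)

module _ {k : ℕ} where

  all-nonempty⇒n≤∣concat∣ : ∀ {n} (ps : Vec (Subset k) n) → (∀ i → Nonempty (lookup ps i)) →
                            n ≤ ∣ concat ps ∣
  all-nonempty⇒n≤∣concat∣ []       _        = z≤n
  all-nonempty⇒n≤∣concat∣ (p ∷ ps) nonempty rewrite ∣p++q∣≡∣p∣+∣q∣ p (concat ps) =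
    +-mono-≤ (nonempty⇒0<∣p∣ (nonempty zero)) (all-nonempty⇒n≤∣concat∣ ps (nonempty ∘ suc))

  ∣concat-map-⁅⁆∣≡n : ∀ {A : Set} {n} (f : A → Fin k) (xs : Vec A n) →
                      ∣ concat (map (λ x → ⁅ f x ⁆) xs) ∣ ≡ n
  ∣concat-map-⁅⁆∣≡n f []       = refl
  ∣concat-map-⁅⁆∣≡n f (x ∷ xs) =
    trans (∣p++q∣≡∣p∣+∣q∣ ⁅ f x ⁆ _) (cong₂ _+_ (∣⁅x⁆∣≡1 (f x)) (∣concat-map-⁅⁆∣≡n f xs))

  combine∈concat⇔ : ∀ {n} {ps : Vec (Subset k) n} {i j} → combine i j ∈ concat ps ⇔ j ∈ lookup ps i
  combine∈concat⇔ {ps = ps} {i} {j} = mk⇔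
    (λ ij∈ → lookup⇒[]= j _ (trans (sym (lookup-concat ps i j)) ([]=⇒lookup ij∈)))
    (λ j∈ → lookup⇒[]= _ _ (trans (lookup-concat ps i j) ([]=⇒lookup j∈)))

  combine∈concat-map⇔ : ∀ {A : Set} {n} (f : A → Subset k) (xs : Vec A n) {i j} →
                        combine i j ∈ concat (map f xs) ⇔ j ∈ f (lookup xs i)
  combine∈concat-map⇔ f xs {i} {j} =
    subst (λ p → combine i j ∈ concat (map f xs) ⇔ j ∈ p) (lookup-map i f xs)
      (combine∈concat⇔ {ps = map f xs})

  concat-⊆⇔ : ∀ {n} {ps qs : Vec (Subset k) n} →
              concat ps ⊆ concat qs ⇔ (∀ i → lookup ps i ⊆ lookup qs i)
  concat-⊆⇔ {n} {ps} {qs} = mk⇔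
    (λ sub i {j} j∈ → to (combine∈concat⇔ {ps = qs}) (sub (from (combine∈concat⇔ {ps = ps}) j∈)))
    (λ sub {e} e∈ →
      let (i , j) = remQuot k e
          ij≡e    = combine-remQuot {n} k e
      in subst (_∈ concat qs) ij≡e (from (combine∈concat⇔ {ps = qs})
           (sub i (to (combine∈concat⇔ {ps = ps}) (subst (_∈ concat ps) (sym ij≡e) e∈)))))

-- Perfect matchings of G n as local conditions

prev : ∀ {m} → Fin (suc m) → Fin (suc m)
prev {m} zero = fromℕ m
prev (suc i)  = inject₁ i

next-fromℕ : ∀ m → next (fromℕ m) ≡ zero
next-fromℕ zero    = refl
next-fromℕ (suc m) rewrite next-fromℕ m = refl

next-inject₁ : ∀ {m} (i : Fin m) → next (inject₁ i) ≡ suc i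
next-inject₁ {suc m} zero    = refl
next-inject₁ {suc m} (suc i) rewrite next-inject₁ i = refl

next-prev : ∀ {m} (j : Fin (suc m)) → next (prev j) ≡ j
next-prev {m} zero = next-fromℕ m
next-prev (suc i)  = next-inject₁ i

prev-next : ∀ {m} (i : Fin (suc m)) → prev (next i) ≡ i
prev-next {zero}  zero    = refl
prev-next {suc m} zero    = refl
prev-next {suc m} (suc i) with next i | prev-next i
... | zero  | eq = cong suc eq
... | suc _ | eq = cong suc eq

Edge : ℕ → Set
Edge n = Fin n × Fin 5

-- Incident (G n) x e  unfolds to  x isEndOf remQuot 5 e.
_isEndOf_ : ∀ {n} → Vtx n → Edge n → Set
x isEndOf (i , k) = x ≡ proj₁ (edgeG i k) ⊎ x ≡ proj₂ (edgeG i k)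

edgeIndex : ∀ {n} → Edge n → Fin (n * 5)
edgeIndex = uncurry combine

remQuot-edgeIndex : ∀ {n} (e : Edge n) → remQuot 5 (edgeIndex e) ≡ e
remQuot-edgeIndex (i , k) = remQuot-combine i k

edgeIndex-injective : ∀ {n} {e f : Edge n} → edgeIndex e ≡ edgeIndex f → e ≡ f
edgeIndex-injective {e = e} {f} eq =
  trans (sym (remQuot-edgeIndex e)) (trans (cong (remQuot 5) eq) (remQuot-edgeIndex f))

degree : ∀ {n} → Vtx n → ℕ
degree (vodd _)  = 3
degree (veven _) = 3
degree (a _)     = 2
degree (b _)     = 2

star : ∀ {m} (x : Vtx (suc m)) → Vec (Edge (suc m)) (degree x)
star (vodd j)  = (prev j , 1F) ∷ (prev j , 4F) ∷ (j , 0F) ∷ []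
star (veven i) = (i , 0F) ∷ (i , 1F) ∷ (i , 2F) ∷ []
star (a i)     = (i , 2F) ∷ (i , 3F) ∷ []
star (b i)     = (i , 3F) ∷ (i , 4F) ∷ []

star-unique : ∀ {m} (x : Vtx (suc m)) → Unique (star x)
star-unique (vodd _)  = ((λ ()) ∷ (λ ()) ∷ []) ∷ ((λ ()) ∷ []) ∷ [] ∷ []
star-unique (veven _) = ((λ ()) ∷ (λ ()) ∷ []) ∷ ((λ ()) ∷ []) ∷ [] ∷ []
star-unique (a _)     = ((λ ()) ∷ []) ∷ [] ∷ []
star-unique (b _)     = ((λ ()) ∷ []) ∷ [] ∷ []

star-isEnd : ∀ {m} (x : Vtx (suc m)) → All (x isEndOf_) (star x)
star-isEnd (vodd j)  =
  inj₂ (cong vodd (sym (next-prev j))) ∷ inj₂ (cong vodd (sym (next-prev j))) ∷ inj₁ refl ∷ []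
star-isEnd (veven _) = inj₂ refl ∷ inj₁ refl ∷ inj₁ refl ∷ []
star-isEnd (a _)     = inj₂ refl ∷ inj₁ refl ∷ []
star-isEnd (b _)     = inj₂ refl ∷ inj₁ refl ∷ []

ends∈star : ∀ {m} (i : Fin (suc m)) k →
            (i , k) ∈ᵛ star (proj₁ (edgeG i k)) × (i , k) ∈ᵛ star (proj₂ (edgeG i k))
ends∈star i 0F = there (there (here refl)) , here refl
ends∈star i 1F = there (here refl) , here (cong (_, 1F) (sym (prev-next i)))
ends∈star i 2F = there (there (here refl)) , here refl
ends∈star i 3F = there (here refl) , here refl
ends∈star i 4F = there (here refl) , there (here (cong (_, 4F) (sym (prev-next i))))

isEnd⇔∈star : ∀ {m} {x : Vtx (suc m)} {e} → x isEndOf e ⇔ e ∈ᵛ star x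
isEnd⇔∈star {x = x} {i , k} = mk⇔
  (λ { (inj₁ refl) → proj₁ (ends∈star i k) ; (inj₂ refl) → proj₂ (ends∈star i k) })
  (All.lookup (star-isEnd x))

incidentEdges : ∀ {m} (x : Vtx (suc m)) → Vec (Fin (suc m * 5)) (degree x)
incidentEdges x = map edgeIndex (star x)

incident⇔∈incidentEdges : ∀ {m} {x : Vtx (suc m)} {e} →
                          Incident (G (suc m)) x e ⇔ e ∈ᵛ incidentEdges x
incident⇔∈incidentEdges {m} {x} {e} = mk⇔
  (λ inc → subst (_∈ᵛ incidentEdges x) (combine-remQuot {suc m} 5 e)
             (∈-map⁺ edgeIndex (to (isEnd⇔∈star {e = remQuot 5 e}) inc)))
  (λ e∈ → let (f , f∈star , e≡f) = fromAny (map⁻ e∈) in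
    subst (x isEndOf_) (sym (trans (cong (remQuot 5) e≡f) (remQuot-edgeIndex f)))
      (from (isEnd⇔∈star {e = f}) f∈star))

-- β i is the set of chosen edges of block i.
localView : ∀ {m} → (Fin (suc m) → Subset 5) → (x : Vtx (suc m)) → Subset (degree x)
localView β x = map (λ (i , k) → lookup (β i) k) (star x)

localView-cong : ∀ {m} {β γ : Fin (suc m) → Subset 5} → (∀ i → β i ≡ γ i) →
                 ∀ x → localView β x ≡ localView γ x
localView-cong β≡γ x = map-cong (λ (i , k) → cong (λ B → lookup B k) (β≡γ i)) (star x)

perfect⇔local : ∀ {m} {ps : Vec (Subset 5) (suc m)} →
                IsPerfectMatching (G (suc m)) (concat ps) ⇔ (∀ x → ∣ localView (lookup ps) x ∣ ≡ 1)
perfect⇔local {m} {ps} =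
  mk⇔ (λ pm x → to (atVertex x) (pm x)) (λ local x → from (atVertex x) (local x))
  where
    incidentView : ∀ x → map (lookup (concat ps)) (incidentEdges x) ≡ localView (lookup ps) x
    incidentView x = trans (sym (map-∘ _ edgeIndex (star x)))
                           (map-cong (λ (i , k) → lookup-concat ps i k) (star x))

    atVertex : ∀ x →
      (∃[ e ] ((e ∈ concat ps × Incident (G (suc m)) x e) ×
               ∀ e′ → e′ ∈ concat ps → Incident (G (suc m)) x e′ → e′ ≡ e))
      ⇔ ∣ localView (lookup ps) x ∣ ≡ 1
    atVertex x rewrite sym (incidentView x) =
      ∃!-member⇔∣map-lookup∣≡1 (concat ps)
        (Unique.map⁺ edgeIndex-injective (star-unique x)) incident⇔∈incidentEdges

-- The three ways to match a block

data Block : Set where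
  short bridge detour : Block

blockEdges : Block → Subset 5
blockEdges short  = inside  ∷ outside ∷ outside ∷ inside  ∷ outside ∷ []
blockEdges bridge = outside ∷ inside  ∷ outside ∷ inside  ∷ outside ∷ []
blockEdges detour = outside ∷ outside ∷ inside  ∷ outside ∷ inside  ∷ []

isShort : Block → Bool
isShort short  = true
isShort bridge = false
isShort detour = false

matching : ∀ {n} → Vec Block n → Subset (n * 5)
matching τ = concat (map blockEdges τ)

-- v_{2j-1} is covered by the short edge of block j or by an edge of the preceding block.
Coherent : ∀ {m} → Vec Block (suc m) → Set
Coherent τ = ∀ j → isShort (lookup τ (prev j)) ≡ isShort (lookup τ j)

local⇒blockEdges : ∀ (B : Subset 5) →
  ∣ lookup B 2F ∷ lookup B 3F ∷ [] ∣ ≡ 1 →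
  ∣ lookup B 3F ∷ lookup B 4F ∷ [] ∣ ≡ 1 →
  ∣ lookup B 0F ∷ lookup B 1F ∷ lookup B 2F ∷ [] ∣ ≡ 1 →
  ∃[ c ] B ≡ blockEdges c
local⇒blockEdges (_       ∷ _       ∷ inside  ∷ inside  ∷ _       ∷ []) () _  _
local⇒blockEdges (_       ∷ _       ∷ outside ∷ outside ∷ _       ∷ []) () _  _
local⇒blockEdges (_       ∷ _       ∷ _       ∷ inside  ∷ inside  ∷ []) _  () _
local⇒blockEdges (_       ∷ _       ∷ _       ∷ outside ∷ outside ∷ []) _  () _
local⇒blockEdges (inside  ∷ outside ∷ outside ∷ inside  ∷ outside ∷ []) _  _  _  = short  , refl
local⇒blockEdges (outside ∷ inside  ∷ outside ∷ inside  ∷ outside ∷ []) _  _  _  = bridge , refl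
local⇒blockEdges (outside ∷ outside ∷ inside  ∷ outside ∷ inside  ∷ []) _  _  _  = detour , refl
local⇒blockEdges (inside  ∷ inside  ∷ outside ∷ inside  ∷ outside ∷ []) _  _  ()
local⇒blockEdges (outside ∷ outside ∷ outside ∷ inside  ∷ outside ∷ []) _  _  ()
local⇒blockEdges (inside  ∷ inside  ∷ inside  ∷ outside ∷ inside  ∷ []) _  _  ()
local⇒blockEdges (inside  ∷ outside ∷ inside  ∷ outside ∷ inside  ∷ []) _  _  ()
local⇒blockEdges (outside ∷ inside  ∷ inside  ∷ outside ∷ inside  ∷ []) _  _  ()

junction : Block → Block → Subset 3
junction c d = lookup (blockEdges c) 1F ∷ lookup (blockEdges c) 4F ∷ lookup (blockEdges d) 0F ∷ []

∣junction∣≡1⇔ : ∀ c d → ∣ junction c d ∣ ≡ 1 ⇔ isShort c ≡ isShort d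
∣junction∣≡1⇔ c d = mk⇔ (⇒ c d) (⇐ c d)
  where
    ⇒ : ∀ c d → ∣ junction c d ∣ ≡ 1 → isShort c ≡ isShort d
    ⇒ short  short  _ = refl
    ⇒ bridge bridge _ = refl
    ⇒ bridge detour _ = refl
    ⇒ detour bridge _ = refl
    ⇒ detour detour _ = refl
    ⇒ short  bridge ()
    ⇒ short  detour ()
    ⇒ bridge short  ()
    ⇒ detour short  ()

    ⇐ : ∀ c d → isShort c ≡ isShort d → ∣ junction c d ∣ ≡ 1
    ⇐ short  short  _ = refl
    ⇐ bridge bridge _ = refl
    ⇐ bridge detour _ = refl
    ⇐ detour bridge _ = refl
    ⇐ detour detour _ = refl
    ⇐ short  bridge ()
    ⇐ short  detour ()
    ⇐ bridge short  ()
    ⇐ detour short  ()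

local⇔coherent : ∀ {m} {τ : Vec Block (suc m)} →
                 (∀ x → ∣ localView (blockEdges ∘ lookup τ) x ∣ ≡ 1) ⇔ Coherent τ
local⇔coherent {τ = τ} = mk⇔
  (λ local j → to (∣junction∣≡1⇔ _ _) (local (vodd j)))
  (λ where coh (vodd j)  → from (∣junction∣≡1⇔ _ _) (coh j)
           coh (veven i) → atEven (lookup τ i)
           coh (a i)     → atA (lookup τ i)
           coh (b i)     → atB (lookup τ i))
  where
    atEven : ∀ c →
      ∣ lookup (blockEdges c) 0F ∷ lookup (blockEdges c) 1F ∷ lookup (blockEdges c) 2F ∷ [] ∣ ≡ 1
    atEven short  = refl
    atEven bridge = refl
    atEven detour = refl

    atA : ∀ c → ∣ lookup (blockEdges c) 2F ∷ lookup (blockEdges c) 3F ∷ [] ∣ ≡ 1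
    atA short  = refl
    atA bridge = refl
    atA detour = refl

    atB : ∀ c → ∣ lookup (blockEdges c) 3F ∷ lookup (blockEdges c) 4F ∷ [] ∣ ≡ 1
    atB short  = refl
    atB bridge = refl
    atB detour = refl

perfect⇔coherent : ∀ {m} {M : Subset (suc m * 5)} →
  IsPerfectMatching (G (suc m)) M ⇔ (∃[ τ ] (Coherent τ × M ≡ matching τ))
perfect⇔coherent {m} {M} =
  mk⇔ ⇒ λ (τ , coh , M≡) → subst (IsPerfectMatching (G (suc m))) (sym M≡) (⇐ {τ} coh)
  where
    ⇐ : ∀ {τ} → Coherent τ → IsPerfectMatching (G (suc m)) (matching τ)
    ⇐ {τ} coh = from (perfect⇔local {ps = map blockEdges τ}) λ x →
      trans (cong ∣_∣ (localView-cong (λ i → lookup-map i blockEdges τ) x))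
            (from (local⇔coherent {τ = τ}) coh x)

    ⇒ : IsPerfectMatching (G (suc m)) M → ∃[ τ ] (Coherent τ × M ≡ matching τ)
    ⇒ pm with group (suc m) 5 M
    ... | ps , refl = τ , to (local⇔coherent {τ = τ}) local-τ , cong concat ps≡
      where
        local : ∀ x → ∣ localView (lookup ps) x ∣ ≡ 1
        local = to (perfect⇔local {ps = ps}) pm

        shape : ∀ i → ∃[ c ] lookup ps i ≡ blockEdges c
        shape i = local⇒blockEdges (lookup ps i) (local (a i)) (local (b i)) (local (veven i))

        τ : Vec Block (suc m)
        τ = tabulate (proj₁ ∘ shape)

        block≡ : ∀ i → lookup ps i ≡ blockEdges (lookup τ i)
        block≡ i = trans (proj₂ (shape i))
                         (cong blockEdges (sym (lookup∘tabulate (proj₁ ∘ shape) i)))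

        ps≡ : ps ≡ map blockEdges τ
        ps≡ = Pointwise-≡⇒≡ (ext λ i → trans (block≡ i) (sym (lookup-map i blockEdges τ)))

        local-τ : ∀ x → ∣ localView (blockEdges ∘ lookup τ) x ∣ ≡ 1
        local-τ x = trans (cong ∣_∣ (sym (localView-cong block≡ x))) (local x)

NoShort : ∀ {n} → Vec Block n → Set
NoShort τ = ∀ i → isShort (lookup τ i) ≡ false

isShort≡true⇒short : ∀ {c} → isShort c ≡ true → c ≡ short
isShort≡true⇒short {short} _ = refl

swap : Block → Block
swap short  = short
swap bridge = detour
swap detour = bridge

isShort-swap : ∀ c → isShort (swap c) ≡ isShort c
isShort-swap short  = refl
isShort-swap bridge = refl
isShort-swap detour = refl

swap-≢ : ∀ {c} → isShort c ≡ false → swap c ≢ c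
swap-≢ {bridge} _ ()
swap-≢ {detour} _ ()

isShort-updateAt-swap : ∀ {n} (τ : Vec Block n) i j →
                        isShort (lookup (updateAt τ i swap) j) ≡ isShort (lookup τ j)
isShort-updateAt-swap τ i j with j ≟ i
... | yes refl = trans (cong isShort (lookup∘updateAt j τ)) (isShort-swap (lookup τ j))
... | no  j≢i  = cong isShort (lookup∘updateAt′ j i j≢i τ)

module _ {m : ℕ} where

  replicate-coherent : ∀ c → Coherent (replicate (suc m) c)
  replicate-coherent c j =
    cong isShort (trans (lookup-replicate (prev j) c) (sym (lookup-replicate j c)))

  noShort⇒coherent : ∀ {τ : Vec Block (suc m)} → NoShort τ → Coherent τ
  noShort⇒coherent noShort j = trans (noShort (prev j)) (sym (noShort j))

  coherent⇒isShort-constant : ∀ {τ : Vec Block (suc m)} → Coherent τ →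
                              ∀ j → isShort (lookup τ j) ≡ isShort (lookup τ zero)
  coherent⇒isShort-constant {τ} coh =
    <-weakInduction (λ j → isShort (lookup τ j) ≡ isShort (lookup τ zero))
      refl (λ i ih → trans (sym (coh (suc i))) ih)

  coherent-cases : ∀ {τ : Vec Block (suc m)} → Coherent τ → τ ≡ replicate (suc m) short ⊎ NoShort τ
  coherent-cases {τ} coh with isShort (lookup τ zero) in τ₀
  ... | true  = inj₁ (Pointwise-≡⇒≡ (ext λ j →
    trans (isShort≡true⇒short (trans (coherent⇒isShort-constant {τ} coh j) τ₀))
          (sym (lookup-replicate j short))))
  ... | false = inj₂ λ j → trans (coherent⇒isShort-constant {τ} coh j) τ₀

  perfect-replicate : ∀ c → IsPerfectMatching (G (suc m)) (matching (replicate (suc m) c))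
  perfect-replicate c = from perfect⇔coherent (_ , replicate-coherent c , refl)

-- Forcing numbers

module _ (H : Graph) where

  forcingNumber-unique : ∀ {M k k′} → ForcingNumber H M k → ForcingNumber H M k′ → k ≡ k′
  forcingNumber-unique ((S , S-forces , ∣S∣≡k) , k-min) ((S′ , S′-forces , ∣S′∣≡k′) , k′-min) =
    ≤-antisym (subst (_ ≤_) ∣S′∣≡k′ (k-min S′ S′-forces)) (subst (_ ≤_) ∣S∣≡k (k′-min S S-forces))

  forcingSet-nonempty : ∀ {M M₁ M₂ S} → IsPerfectMatching H M₁ → IsPerfectMatching H M₂ → M₁ ≢ M₂ →
                        IsForcingSet H M S → Nonempty S
  forcingSet-nonempty {S = S} pm₁ pm₂ M₁≢M₂ (_ , forces) with nonempty? S
  ... | yes nonempty = nonempty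
  ... | no  empty    = ⊥-elim (M₁≢M₂ (trans (forces _ pm₁ S⊆) (sym (forces _ pm₂ S⊆))))
    where
      S⊆ : ∀ {M′} → S ⊆ M′
      S⊆ rewrite Empty-unique empty = ⊥⊆

marker : Block → Fin 5
marker short  = 0F
marker bridge = 1F
marker detour = 2F

marker∈blockEdges : ∀ c → marker c ∈ blockEdges c
marker∈blockEdges short  = here
marker∈blockEdges bridge = there here
marker∈blockEdges detour = there (there here)

marker∈blockEdges⇒≡ : ∀ {c d} → marker c ∈ blockEdges d → c ≡ d
marker∈blockEdges⇒≡ {short}  {short}  _ = refl
marker∈blockEdges⇒≡ {bridge} {bridge} _ = refl
marker∈blockEdges⇒≡ {detour} {detour} _ = refl
marker∈blockEdges⇒≡ {short}  {bridge} ()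
marker∈blockEdges⇒≡ {short}  {detour} ()
marker∈blockEdges⇒≡ {bridge} {short}  (there ())
marker∈blockEdges⇒≡ {bridge} {detour} (there ())
marker∈blockEdges⇒≡ {detour} {short}  (there (there ()))
marker∈blockEdges⇒≡ {detour} {bridge} (there (there ()))

markers : ∀ {n} → Vec Block n → Subset (n * 5)
markers τ = concat (map (λ c → ⁅ marker c ⁆) τ)

matching-injective : ∀ {n} {τ τ′ : Vec Block n} → matching τ ≡ matching τ′ → τ ≡ τ′
matching-injective {τ = τ} {τ′} eq = Pointwise-≡⇒≡ (ext λ i →
  marker∈blockEdges⇒≡ (to (combine∈concat-map⇔ blockEdges τ′)
    (subst (combine i (marker (lookup τ i)) ∈_) eq
      (from (combine∈concat-map⇔ blockEdges τ) (marker∈blockEdges _)))))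

module _ {m : ℕ} where

  markers⊆matching : ∀ (τ : Vec Block (suc m)) → markers τ ⊆ matching τ
  markers⊆matching τ =
    from (concat-⊆⇔ {ps = map (λ c → ⁅ marker c ⁆) τ} {map blockEdges τ}) λ i {k} k∈ →
    subst (k ∈_) (sym (lookup-map i blockEdges τ))
      (subst (_∈ blockEdges (lookup τ i)) (sym (x∈⁅y⁆⇒x≡y _ (subst (k ∈_) (lookup-map i _ τ) k∈)))
        (marker∈blockEdges (lookup τ i)))

  markers⊆matching⇒≡ : ∀ {τ τ′ : Vec Block (suc m)} → markers τ ⊆ matching τ′ → τ ≡ τ′
  markers⊆matching⇒≡ {τ} {τ′} sub = Pointwise-≡⇒≡ (ext λ i →
    marker∈blockEdges⇒≡ (to (combine∈concat-map⇔ blockEdges τ′)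
      (sub (from (combine∈concat-map⇔ (λ c → ⁅ marker c ⁆) τ) (x∈⁅x⁆ (marker (lookup τ i)))))))

  forcingNumber-allShort : ForcingNumber (G (suc m)) (matching (replicate (suc m) short)) 1
  forcingNumber-allShort =
    (⁅0⁆ , (⁅0⁆⊆ , forces) , ∣⁅x⁆∣≡1 {suc m * 5} zero) ,
    λ S S-forces → nonempty⇒0<∣p∣ (forcingSet-nonempty (G (suc m))
      (perfect-replicate short) (perfect-replicate bridge) short≢bridge S-forces)
    where
      ⁅0⁆ : Subset (suc m * 5)
      ⁅0⁆ = ⁅ zero ⁆

      ⁅0⁆⊆ : ⁅0⁆ ⊆ matching (replicate (suc m) short)
      ⁅0⁆⊆ x∈ rewrite x∈⁅y⁆⇒x≡y zero x∈ = here

      forces : ∀ M′ → IsPerfectMatching (G (suc m)) M′ → ⁅0⁆ ⊆ M′ →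
               M′ ≡ matching (replicate (suc m) short)
      forces M′ pm′ ⁅0⁆⊆M′ with to (perfect⇔coherent {M = M′}) pm′
      ... | τ′ , coh′ , refl with coherent-cases {τ = τ′} coh′
      ...   | inj₁ τ′≡    = cong matching τ′≡
      ...   | inj₂ noShort
        with () ← trans (cong isShort (marker∈blockEdges⇒≡
                    (to (combine∈concat-map⇔ blockEdges τ′ {zero} {0F}) (⁅0⁆⊆M′ (x∈⁅x⁆ zero)))))
                  (noShort zero)

      short≢bridge : matching (replicate (suc m) short) ≢ matching (replicate (suc m) bridge)
      short≢bridge eq with () ← ∷-injectiveˡ
        (matching-injective {τ = replicate (suc m) short} {replicate (suc m) bridge} eq)

  -- If S misses block i, swapping bridge and detour there gives another perfect matching ⊇ S.
  forcingSet-meets-every-block : ∀ {τ : Vec Block (suc m)} {ps : Vec (Subset 5) (suc m)} →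
    NoShort τ → IsForcingSet (G (suc m)) (matching τ) (concat ps) → ∀ i → Nonempty (lookup ps i)
  forcingSet-meets-every-block {τ} {ps} noShort (S⊆ , forces) i with nonempty? (lookup ps i)
  ... | yes nonempty = nonempty
  ... | no  empty    = ⊥-elim (swap-≢ (noShort i)
                         (trans (sym (lookup∘updateAt i τ)) (cong (λ v → lookup v i) τ′≡τ)))
    where
      τ′ : Vec Block (suc m)
      τ′ = updateAt τ i swap

      S⊆′ : concat ps ⊆ matching τ′
      S⊆′ = from (concat-⊆⇔ {ps = ps} {map blockEdges τ′}) blockwise
        where
          blockwise : ∀ j → lookup ps j ⊆ lookup (map blockEdges τ′) j
          blockwise j with j ≟ i
          ... | yes refl rewrite Empty-unique empty = ⊥⊆
          ... | no  j≢i  rewrite lookup-map j blockEdges τ′ | lookup∘updateAt′ j i {swap} j≢i τ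
                               | sym (lookup-map j blockEdges τ) =
            to (concat-⊆⇔ {ps = ps} {map blockEdges τ}) S⊆ j

      τ′≡τ : τ′ ≡ τ
      τ′≡τ = matching-injective {τ = τ′} {τ} (forces _ (from perfect⇔coherent
        (τ′ , noShort⇒coherent {τ = τ′} (λ j → trans (isShort-updateAt-swap τ i j) (noShort j)) , refl))
        S⊆′)

  forcingNumber-noShort : ∀ {τ : Vec Block (suc m)} → NoShort τ →
                          ForcingNumber (G (suc m)) (matching τ) (suc m)
  forcingNumber-noShort {τ} noShort =
    (markers τ , (markers⊆matching τ , forces) , ∣concat-map-⁅⁆∣≡n marker τ) , atLeast
    where
      forces : ∀ M′ → IsPerfectMatching (G (suc m)) M′ → markers τ ⊆ M′ → M′ ≡ matching τ
      forces M′ pm′ sub with to (perfect⇔coherent {M = M′}) pm′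
      ... | τ′ , _ , refl = cong matching (sym (markers⊆matching⇒≡ {τ} {τ′} sub))

      atLeast : ∀ S → IsForcingSet (G (suc m)) (matching τ) S → suc m ≤ ∣ S ∣
      atLeast S S-forces with group (suc m) 5 S
      ... | ps , refl =
        all-nonempty⇒n≤∣concat∣ ps (forcingSet-meets-every-block {τ = τ} {ps} noShort S-forces)

-- The hypothesis n ≥ 2 only excludes n = 0: the argument also covers n = 1.
mainTheorem2 : ∀ (n : ℕ) → 2 ≤ n →
    ∀ (k : ℕ) → InSpec (G n) k ⇔ (k ≡ 1 ⊎ k ≡ n)
mainTheorem2 zero    () k
mainTheorem2 (suc m) _  k = mk⇔ spec⇒ spec⇐
  where
    spec⇒ : InSpec (G (suc m)) k → k ≡ 1 ⊎ k ≡ suc m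
    spec⇒ (M , pm , fn) with to perfect⇔coherent pm
    ... | τ , coh , refl with coherent-cases {τ = τ} coh
    ...   | inj₁ refl    = inj₁ (forcingNumber-unique _ fn forcingNumber-allShort)
    ...   | inj₂ noShort = inj₂ (forcingNumber-unique _ fn (forcingNumber-noShort {τ = τ} noShort))

    spec⇐ : k ≡ 1 ⊎ k ≡ suc m → InSpec (G (suc m)) k
    spec⇐ (inj₁ refl) = _ , perfect-replicate short , forcingNumber-allShort
    spec⇐ (inj₂ refl) = _ , perfect-replicate bridge ,
      forcingNumber-noShort (λ i → cong isShort (lookup-replicate i bridge))
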